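{- Let $r>2$ be an integer and let $m,n$ be integers with $2r+1<m\le n$. If the graph of an $\{r,r+1\}$-leaper on an $m\times n$ board has a Hamiltonian circuit, then $m\ge 4r+2$.
   Context: For positive integers $r,s$, the graph of an $\{r,s\}$-leaper on an $m\times n$ board has vertex set $\{(x,y): 0\le x<m,\ 0\le y<n\}$ (integers), with an edge between $(x,y)$ and $(x',y')$ whenever $(x'-x,y'-y)\in\{(\pm r,\pm s),(\pm s,\pm r)\}$. A Hamiltonian circuit is a cycle in the graph passing through every vertex exactly once. -}

module Defs where

open import Data.Nat using (ℕ; suc; _*_; _∸_; ∣_-_∣)
open import Data.Fin using (Fin; toℕ)
open import Data.Product using (_×_; _,_; Σ)
open import Data.Sum using (_⊎_)
open import Relation.Binary.PropositionalEquality using (_≡_)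
open import Function.Definitions using (Bijective)

Square : ℕ → ℕ → Set
Square m n = Fin m × Fin n

LeaperAdj : ∀ {m n} → ℕ → ℕ → Square m n → Square m n → Set
LeaperAdj r s (x , y) (x' , y') =
  (∣ toℕ x - toℕ x' ∣ ≡ r × ∣ toℕ y - toℕ y' ∣ ≡ s)
  ⊎ (∣ toℕ x - toℕ x' ∣ ≡ s × ∣ toℕ y - toℕ y' ∣ ≡ r)

CyclicSucc : ∀ {N} → Fin N → Fin N → Set
CyclicSucc {N} i j =
  toℕ j ≡ suc (toℕ i) ⊎ (toℕ i ≡ N ∸ 1 × toℕ j ≡ 0)

-- A Hamiltonian circuit of the {r,s}-leaper graph on the m × n board:
-- a cyclic enumeration c₀, c₁, …, c_{mn-1} of all squares, each exactly
-- once (c is a bijection), with consecutive squares (including c_{mn-1},c₀)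
-- joined by an edge.
HamiltonianCircuit : ℕ → ℕ → ℕ → ℕ → Set
HamiltonianCircuit r s m n =
  Σ (Fin (m * n) → Square m n) λ c →
    Bijective _≡_ _≡_ c
    × (∀ i j → CyclicSucc i j → LeaperAdj r s (c i) (c j))

{-# OPTIONS --safe #-}
module Submission where

open import Defs
open import Data.Nat using (ℕ; zero; suc; _+_; _*_; _∸_; _<_; _≤_; z≤n; s≤s; z<s; ∣_-_∣; _<?_; _≤?_)
open import Data.Nat.Properties
open import Data.Nat.Tactic.RingSolver using (solve-∀)
open import Data.Fin using (Fin; zero; suc; toℕ; fromℕ; fromℕ<; inject₁)
open import Data.Fin.Properties using (toℕ-injective; toℕ-fromℕ; toℕ-fromℕ<; toℕ-inject₁; toℕ<n)
open import Data.Product using (∃; ∃₂; _×_; _,_; proj₁; proj₂)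
import Data.Product as Product
open import Data.Sum using (_⊎_; inj₁; inj₂; swap; [_,_])
import Data.Sum as Sum
open import Data.Empty using (⊥; ⊥-elim)
open import Function using (_∘_)
open import Function.Definitions using (Bijective)
open import Relation.Binary.Definitions using (Symmetric)
open import Relation.Nullary using (¬_; yes; no)
open import Relation.Binary.PropositionalEquality using (_≡_; _≢_; refl; sym; trans; cong; cong₂; subst; subst₂)

-- In a Hamiltonian circuit every square has exactly two circuit neighbours, so a square with
-- only two leaper neighbours is joined to both of them, and no square is joined to three
-- others. For the {r, r+1}-leaper a square (x, y) with y < r has at most two neighbours when
-- x < r or m ≤ x + r. With f + 1 < r, the squares (f+1, 0) and (f, 1) therefore use up both
-- circuit edges at their common neighbour, the apex (f+1+r, r+1). If 2r+1 < m ≤ 4r, a square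
-- near the bottom-right corner is forced onto such an apex as well. If m = 4r + 1, the square
-- (3r, 1) cannot be joined to the saturated apex (2r-1, r+1), so it is joined to (2r, r+2),
-- which is already forced onto (r-1, 2) and (3r+1, 2).

∣m-n∣≡o⇒n≡m+o⊎m≡n+o : ∀ m n {o} → ∣ m - n ∣ ≡ o → n ≡ m + o ⊎ m ≡ n + o
∣m-n∣≡o⇒n≡m+o⊎m≡n+o zero    n       refl = inj₁ refl
∣m-n∣≡o⇒n≡m+o⊎m≡n+o (suc m) zero    refl = inj₂ refl
∣m-n∣≡o⇒n≡m+o⊎m≡n+o (suc m) (suc n) eq   = Sum.map (cong suc) (cong suc) (∣m-n∣≡o⇒n≡m+o⊎m≡n+o m n eq)

m≡n+o⇒n≡m∸o : ∀ {m n o} → m ≡ n + o → n ≡ m ∸ o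
m≡n+o⇒n≡m∸o {n = n} {o} refl = sym (m+n∸n≡m n o)

∣m-n∣≡o⇒n≡m+o : ∀ {m n o} → m < o → ∣ m - n ∣ ≡ o → n ≡ m + o
∣m-n∣≡o⇒n≡m+o {m} {n} {o} m<o eq with ∣m-n∣≡o⇒n≡m+o⊎m≡n+o m n eq
... | inj₁ n≡m+o = n≡m+o
... | inj₂ m≡n+o = ⊥-elim (<⇒≱ m<o (subst (o ≤_) (sym m≡n+o) (m≤n+m o n)))

∣m-n∣≡o⇒n≡m∸o : ∀ {m n o} → n < m + o → ∣ m - n ∣ ≡ o → n ≡ m ∸ o
∣m-n∣≡o⇒n≡m∸o {m} {n} n<m+o eq with ∣m-n∣≡o⇒n≡m+o⊎m≡n+o m n eq
... | inj₁ n≡m+o = ⊥-elim (<-irrefl n≡m+o n<m+o)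
... | inj₂ m≡n+o = m≡n+o⇒n≡m∸o m≡n+o

∣m+n-m∣≡n : ∀ m n → ∣ m + n - m ∣ ≡ n
∣m+n-m∣≡n m n = trans (∣-∣-comm (m + n) m) (∣m-m+n∣≡n m n)

∣m-1+m+n∣≡1+n : ∀ m n → ∣ m - suc (m + n) ∣ ≡ suc n
∣m-1+m+n∣≡1+n m n = subst (λ k → ∣ m - k ∣ ≡ suc n) (+-suc m n) (∣m-m+n∣≡n m (suc n))

no-index-after-last : ∀ {N} {i : Fin N} (j : Fin N) → toℕ i ≡ N ∸ 1 → toℕ j ≢ suc (toℕ i)
no-index-after-last {N = suc N} j i-last j≡ = <-irrefl (trans j≡ (cong suc i-last)) (toℕ<n j)

CyclicSucc-functional : ∀ {N} {i j k : Fin N} → CyclicSucc i j → CyclicSucc i k → j ≡ k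
CyclicSucc-functional (inj₁ j≡) (inj₁ k≡) = toℕ-injective (trans j≡ (sym k≡))
CyclicSucc-functional (inj₂ (_ , j≡0)) (inj₂ (_ , k≡0)) = toℕ-injective (trans j≡0 (sym k≡0))
CyclicSucc-functional {j = j} (inj₁ j≡) (inj₂ (i-last , _)) = ⊥-elim (no-index-after-last j i-last j≡)
CyclicSucc-functional {k = k} (inj₂ (i-last , _)) (inj₁ k≡) = ⊥-elim (no-index-after-last k i-last k≡)

CyclicSucc-injective : ∀ {N} {i j k : Fin N} → CyclicSucc i k → CyclicSucc j k → i ≡ j
CyclicSucc-injective (inj₁ k≡) (inj₁ k≡′) = toℕ-injective (suc-injective (trans (sym k≡) k≡′))
CyclicSucc-injective (inj₂ (i-last , _)) (inj₂ (j-last , _)) = toℕ-injective (trans i-last (sym j-last))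
CyclicSucc-injective (inj₁ k≡) (inj₂ (_ , k≡0)) = ⊥-elim (1+n≢0 (trans (sym k≡) k≡0))
CyclicSucc-injective (inj₂ (_ , k≡0)) (inj₁ k≡) = ⊥-elim (1+n≢0 (trans (sym k≡) k≡0))

CyclicSucc-total : ∀ {N} (i : Fin N) → ∃ (CyclicSucc i)
CyclicSucc-total {N = suc N} i with toℕ i <? N
... | yes i<N = fromℕ< (s≤s i<N) , inj₁ (toℕ-fromℕ< (s≤s i<N))
... | no i≮N = zero , inj₂ (≤-antisym (≤-pred (toℕ<n i)) (≮⇒≥ i≮N) , refl)

CyclicSucc-surjective : ∀ {N} (j : Fin N) → ∃ λ i → CyclicSucc i j
CyclicSucc-surjective {N = suc N} zero = fromℕ N , inj₂ (toℕ-fromℕ N , refl)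
CyclicSucc-surjective (suc j) = inject₁ j , inj₁ (cong suc (sym (toℕ-inject₁ j)))

CyclicSucc-asym : ∀ {N} {i j : Fin N} → 3 ≤ N → CyclicSucc i j → CyclicSucc j i → ⊥
CyclicSucc-asym {i = i} _ (inj₁ j≡) (inj₁ i≡) = m≢1+n+m (toℕ i) (trans i≡ (cong suc j≡))
CyclicSucc-asym (s≤s (s≤s (s≤s _))) (inj₁ j≡) (inj₂ (j-last , i≡0))
  with trans (sym j-last) (trans j≡ (cong suc i≡0))
... | ()
CyclicSucc-asym (s≤s (s≤s (s≤s _))) (inj₂ (i-last , j≡0)) (inj₁ i≡)
  with trans (sym i-last) (trans i≡ (cong suc j≡0))
... | ()
CyclicSucc-asym (s≤s (s≤s (s≤s _))) (inj₂ (i-last , _)) (inj₂ (_ , i≡0))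
  with trans (sym i-last) i≡0
... | ()

CyclicAdjacent : ∀ {N} → Fin N → Fin N → Set
CyclicAdjacent i j = CyclicSucc i j ⊎ CyclicSucc j i

CyclicAdjacent-pigeonhole : ∀ {N} {i j k l : Fin N} →
                            CyclicAdjacent k i → CyclicAdjacent k j → CyclicAdjacent k l →
                            i ≡ j ⊎ i ≡ l ⊎ j ≡ l
CyclicAdjacent-pigeonhole (inj₁ ki) (inj₁ kj) _         = inj₁ (CyclicSucc-functional ki kj)
CyclicAdjacent-pigeonhole (inj₂ ik) (inj₂ jk) _         = inj₁ (CyclicSucc-injective ik jk)
CyclicAdjacent-pigeonhole (inj₁ ki) (inj₂ _)  (inj₁ kl) = inj₂ (inj₁ (CyclicSucc-functional ki kl))
CyclicAdjacent-pigeonhole (inj₂ ik) (inj₁ _)  (inj₂ lk) = inj₂ (inj₁ (CyclicSucc-injective ik lk))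
CyclicAdjacent-pigeonhole (inj₁ _)  (inj₂ jk) (inj₂ lk) = inj₂ (inj₂ (CyclicSucc-injective jk lk))
CyclicAdjacent-pigeonhole (inj₂ _)  (inj₁ kj) (inj₁ kl) = inj₂ (inj₂ (CyclicSucc-functional kj kl))

-- Circuit neighbours in a cyclic enumeration

AtMostOne : {A : Set} → (A → Set) → Set
AtMostOne P = ∀ {v w} → P v → P w → v ≡ w

module Circuit {A : Set} {N : ℕ} (3≤N : 3 ≤ N) {c : Fin N → A} (c-bijective : Bijective _≡_ _≡_ c) where

  private
    c-injective = proj₁ c-bijective
    c-surjective = proj₂ c-bijective

  Consecutive : A → A → Set
  Consecutive u v = ∃₂ λ i j → c i ≡ u × c j ≡ v × CyclicAdjacent i j

  Consecutive-sym : ∀ {u v} → Consecutive u v → Consecutive v u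
  Consecutive-sym (i , j , ci≡u , cj≡v , ij) = j , i , cj≡v , ci≡u , swap ij

  two-neighbours : ∀ u → ∃₂ λ v w → v ≢ w × Consecutive u v × Consecutive u w
  two-neighbours u
    with k , ck≡u ← c-surjective u
    with j , k→j ← CyclicSucc-total k | i , i→k ← CyclicSucc-surjective k
    = c j , c i , cj≢ci , (k , j , ck≡u refl , refl , inj₁ k→j) , (k , i , ck≡u refl , refl , inj₂ i→k)
    where
    cj≢ci : c j ≢ c i
    cj≢ci cj≡ci = CyclicSucc-asym 3≤N k→j (subst (λ h → CyclicSucc h k) (sym (c-injective cj≡ci)) i→k)

  no-three-neighbours : ∀ {u a b d} → Consecutive u a → Consecutive u b → Consecutive u d →
                        a ≢ b → a ≢ d → b ≢ d → ⊥
  no-three-neighbours (k , i , refl , refl , ki) (k′ , j , ck′≡ck , refl , k′j) (k″ , l , ck″≡ck , refl , k″l)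
                      a≢b a≢d b≢d
    with refl ← c-injective ck′≡ck | refl ← c-injective ck″≡ck
    with CyclicAdjacent-pigeonhole ki k′j k″l
  ... | inj₁ i≡j        = a≢b (cong c i≡j)
  ... | inj₂ (inj₁ i≡l) = a≢d (cong c i≡l)
  ... | inj₂ (inj₂ j≡l) = b≢d (cong c j≡l)

  consecutive-satisfying : ∀ {u} {P Q : A → Set} → AtMostOne Q →
                           (∀ {v} → Consecutive u v → P v ⊎ Q v) → ∃ λ v → P v × Consecutive u v
  consecutive-satisfying {u} Q-unique cover with two-neighbours u
  ... | v , w , v≢w , u—v , u—w with cover u—v | cover u—w
  ...   | inj₁ Pv | _       = v , Pv , u—v
  ...   | inj₂ _  | inj₁ Pw = w , Pw , u—w
  ...   | inj₂ Qv | inj₂ Qw = ⊥-elim (v≢w (Q-unique Qv Qw))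

  module Edges {E : A → A → Set} (E-sym : Symmetric E)
               (c-edges : ∀ i j → CyclicSucc i j → E (c i) (c j)) where

    consecutive⇒adjacent : ∀ {u v} → Consecutive u v → E u v
    consecutive⇒adjacent (i , j , refl , refl , inj₁ i→j) = c-edges i j i→j
    consecutive⇒adjacent (i , j , refl , refl , inj₂ j→i) = E-sym (c-edges j i j→i)

    adjacent⇒consecutive : ∀ {u v} {P Q : A → Set} → AtMostOne P → AtMostOne Q →
                           (∀ {w} → E u w → P w ⊎ Q w) → E u v → Consecutive u v
    adjacent⇒consecutive P-unique Q-unique cover uv =
      [ satisfying⇒consecutive P-unique Q-unique cover
      , satisfying⇒consecutive Q-unique P-unique (swap ∘ cover)
      ] (cover uv)
      where
      satisfying⇒consecutive : ∀ {u v} {P Q : A → Set} → AtMostOne P → AtMostOne Q →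
                               (∀ {w} → E u w → P w ⊎ Q w) → P v → Consecutive u v
      satisfying⇒consecutive P-unique Q-unique cover Pv
        with w , Pw , u—w ← consecutive-satisfying Q-unique (cover ∘ consecutive⇒adjacent)
        = subst (Consecutive _) (P-unique Pw Pv) u—w

col row : ∀ {m n} → Square m n → ℕ
col u = toℕ (proj₁ u)
row u = toℕ (proj₂ u)

At : ∀ {m n} → Square m n → ℕ → ℕ → Set
At u x y = col u ≡ x × row u ≡ y

At-unique : ∀ {m n x y} → AtMostOne (λ (u : Square m n) → At u x y)
At-unique (ux≡x , uy≡y) (vx≡x , vy≡y) =
  cong₂ _,_ (toℕ-injective (trans ux≡x (sym vx≡x))) (toℕ-injective (trans uy≡y (sym vy≡y)))

At⇒x<m : ∀ {m n x y} {u : Square m n} → At u x y → x < m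
At⇒x<m {u = u} (refl , _) = toℕ<n (proj₁ u)

At-distinct-col : ∀ {m n x y x′ y′} {u v : Square m n} → At u x y → At v x′ y′ → x ≢ x′ → u ≢ v
At-distinct-col (refl , _) (refl , _) x≢x′ refl = x≢x′ refl

At-distinct-row : ∀ {m n x y x′ y′} {u v : Square m n} → At u x y → At v x′ y′ → y ≢ y′ → u ≢ v
At-distinct-row (_ , refl) (_ , refl) y≢y′ refl = y≢y′ refl

square : ∀ {m n x y} → x < m → y < n → Square m n
square x<m y<n = fromℕ< x<m , fromℕ< y<n

square-at : ∀ {m n x y} (x<m : x < m) (y<n : y < n) → At (square x<m y<n) x y
square-at x<m y<n = toℕ-fromℕ< x<m , toℕ-fromℕ< y<n

LeaperAdj-sym : ∀ {m n r s} → Symmetric (LeaperAdj {m} {n} r s)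
LeaperAdj-sym {x = x , y} {x′ , y′} = Sum.map (Product.map flip-x flip-y) (Product.map flip-x flip-y)
  where
  flip-x : ∀ {d} → ∣ toℕ x - toℕ x′ ∣ ≡ d → ∣ toℕ x′ - toℕ x ∣ ≡ d
  flip-x = trans (∣-∣-comm (toℕ x′) (toℕ x))
  flip-y : ∀ {d} → ∣ toℕ y - toℕ y′ ∣ ≡ d → ∣ toℕ y′ - toℕ y ∣ ≡ d
  flip-y = trans (∣-∣-comm (toℕ y′) (toℕ y))

adjacent-at : ∀ {m n r s x y x′ y′} {u v : Square m n} → At u x y → At v x′ y′ →
              (∣ x - x′ ∣ ≡ r × ∣ y - y′ ∣ ≡ s) ⊎ (∣ x - x′ ∣ ≡ s × ∣ y - y′ ∣ ≡ r) →
              LeaperAdj r s u v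
adjacent-at (refl , refl) (refl , refl) d = d

low-row-neighbour : ∀ {r m n x y} {u v : Square m n} → At u x y → y < r → LeaperAdj r (suc r) u v →
                    (∣ x - col v ∣ ≡ r × row v ≡ y + suc r) ⊎ (∣ x - col v ∣ ≡ suc r × row v ≡ y + r)
low-row-neighbour (refl , refl) y<r (inj₁ (dx , dy)) = inj₁ (dx , ∣m-n∣≡o⇒n≡m+o (m<n⇒m<1+n y<r) dy)
low-row-neighbour (refl , refl) y<r (inj₂ (dx , dy)) = inj₂ (dx , ∣m-n∣≡o⇒n≡m+o y<r dy)

corner-neighbour : ∀ {r m n x y} {u v : Square m n} → At u x y → x < r → y < r → LeaperAdj r (suc r) u v →
                   At v (x + r) (y + suc r) ⊎ At v (x + suc r) (y + r)
corner-neighbour at-u x<r y<r adj with low-row-neighbour at-u y<r adj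
... | inj₁ (dx , dy) = inj₁ (∣m-n∣≡o⇒n≡m+o x<r dx , dy)
... | inj₂ (dx , dy) = inj₂ (∣m-n∣≡o⇒n≡m+o (m<n⇒m<1+n x<r) dx , dy)

right-edge-neighbour : ∀ {r m n x y} {u v : Square m n} → At u x y → m ≤ x + r → y < r →
                       LeaperAdj r (suc r) u v → At v (x ∸ r) (y + suc r) ⊎ At v (x ∸ suc r) (y + r)
right-edge-neighbour {r} {m} {x = x} {v = v} at-u m≤x+r y<r adj with low-row-neighbour at-u y<r adj
... | inj₁ (dx , dy) = inj₁ (∣m-n∣≡o⇒n≡m∸o (<-≤-trans (toℕ<n (proj₁ v)) m≤x+r) dx , dy)
... | inj₂ (dx , dy) = inj₂ (∣m-n∣≡o⇒n≡m∸o (<-≤-trans (toℕ<n (proj₁ v)) m≤x+1+r) dx , dy)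
  where
  m≤x+1+r : m ≤ x + suc r
  m≤x+1+r = ≤-trans m≤x+r (+-monoʳ-≤ x (n≤1+n r))

near-right-edge-neighbour : ∀ {r m n x y} {u v : Square m n} → At u x y → m ≤ x + suc r → y < r →
                            LeaperAdj r (suc r) u v →
                            At v (x ∸ r) (y + suc r) ⊎ At v (x + r) (y + suc r) ⊎ At v (x ∸ suc r) (y + r)
near-right-edge-neighbour {x = x} {v = v} at-u m≤x+1+r y<r adj with low-row-neighbour at-u y<r adj
... | inj₁ (dx , dy) =
  [ (λ col≡ → inj₂ (inj₁ (col≡ , dy))) , (λ x≡ → inj₁ (m≡n+o⇒n≡m∸o x≡ , dy)) ]
    (∣m-n∣≡o⇒n≡m+o⊎m≡n+o x (col v) dx)
... | inj₂ (dx , dy) = inj₂ (inj₂ (∣m-n∣≡o⇒n≡m∸o (<-≤-trans (toℕ<n (proj₁ v)) m≤x+1+r) dx , dy))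

-- Hamiltonian circuits of the {r, r+1}-leaper

module LeaperCircuit {r m n : ℕ} (3≤mn : 3 ≤ m * n) {c : Fin (m * n) → Square m n}
  (c-bijective : Bijective _≡_ _≡_ c)
  (c-edges : ∀ i j → CyclicSucc i j → LeaperAdj r (suc r) (c i) (c j)) where

  open Circuit 3≤mn c-bijective
  open Edges (λ {u v} → LeaperAdj-sym {x = u} {v}) c-edges

  corner-consecutive : ∀ {u v x y} → At u x y → x < r → y < r → LeaperAdj r (suc r) u v → Consecutive v u
  corner-consecutive at-u x<r y<r u~v =
    Consecutive-sym (adjacent⇒consecutive At-unique At-unique (corner-neighbour at-u x<r y<r) u~v)

  right-edge-consecutive : ∀ {u v x y} → At u x y → m ≤ x + r → y < r → LeaperAdj r (suc r) u v →
                           Consecutive v u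
  right-edge-consecutive at-u m≤x+r y<r u~v =
    Consecutive-sym (adjacent⇒consecutive At-unique At-unique (right-edge-neighbour at-u m≤x+r y<r) u~v)

  near-right-edge-consecutive : ∀ {u v w x y} → At u (suc x + r) y → m ≤ suc x + r + suc r → y < r →
                                At v x (y + r) → ¬ Consecutive u v → At w (suc x) (y + suc r) →
                                Consecutive u w
  near-right-edge-consecutive {u} {x = x} {y} at-u m≤ y<r at-v u≁v at-w
    = let w′ , at-w′ , u—w′ = consecutive-satisfying At-unique cover
      in subst (Consecutive u) (At-unique at-w′ at-w) u—w′
    where
    cover : ∀ {v′} → Consecutive u v′ → At v′ (suc x) (y + suc r) ⊎ At v′ (suc x + r + r) (y + suc r)
    cover u—v′ with near-right-edge-neighbour at-u m≤ y<r (consecutive⇒adjacent u—v′)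
    ... | inj₁ (col≡ , row≡) = inj₁ (trans col≡ (m+n∸n≡m (suc x) r) , row≡)
    ... | inj₂ (inj₁ at-v′) = inj₂ at-v′
    ... | inj₂ (inj₂ (col≡ , row≡)) =
      ⊥-elim (u≁v (subst (Consecutive u) (At-unique (trans col≡ (m+n∸n≡m x r) , row≡) at-v) u—v′))

  -- The apex (f+1+r, r+1) is forced onto the corner squares (f+1, 0) and (f, 1).
  apex-consecutive⇒col<r : ∀ {f w v x y} → suc f < r → suc r < n → At w (suc f + r) (suc r) →
                           Consecutive w v → At v x y → x < r
  apex-consecutive⇒col<r {f} {w} {v} {x} f+1<r r+1<n at-w w—v at-v with x <? r
  ... | yes x<r = x<r
  ... | no x≮r = ⊥-elim (no-three-neighbours w—P₁ w—P₂ w—v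
                           (At-distinct-row at-P₁ at-P₂ λ ())
                           (At-distinct-col at-P₁ at-v (<⇒≢ f+1<x))
                           (At-distinct-col at-P₂ at-v (<⇒≢ (<-trans (n<1+n f) f+1<x))))
    where
    f+1<x : suc f < x
    f+1<x = <-≤-trans f+1<r (≮⇒≥ x≮r)
    1<r : 1 < r
    1<r = ≤-<-trans (s≤s z≤n) f+1<r
    1<n : 1 < n
    1<n = <-trans 1<r (<-trans (n<1+n r) r+1<n)
    f+1<m : suc f < m
    f+1<m = ≤-<-trans (m≤m+n (suc f) r) (At⇒x<m at-w)
    f<m : f < m
    f<m = <-trans (n<1+n f) f+1<m
    P₁ P₂ : Square m n
    P₁ = square f+1<m (<-trans z<s 1<n)
    P₂ = square f<m 1<n
    at-P₁ : At P₁ (suc f) 0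
    at-P₁ = square-at f+1<m (<-trans z<s 1<n)
    at-P₂ : At P₂ f 1
    at-P₂ = square-at f<m 1<n
    w—P₁ : Consecutive w P₁
    w—P₁ = corner-consecutive at-P₁ f+1<r (<-trans z<s 1<r)
             (adjacent-at at-P₁ at-w (inj₁ (∣m-m+n∣≡n (suc f) r , refl)))
    w—P₂ : Consecutive w P₂
    w—P₂ = corner-consecutive at-P₂ (<-trans (n<1+n f) f+1<r) 1<r
             (adjacent-at at-P₂ at-w (inj₂ (∣m-1+m+n∣≡1+n f r , refl)))

  no-circuit-for-m≤3r+1 : 1 < r → suc r + r < m → m ≤ suc r + r + r → suc r < n → ⊥
  no-circuit-for-m≤3r+1 1<r 2r+1<m m≤3r+1 r+1<n =
    <⇒≱ (apex-consecutive⇒col<r 1<r r+1<n at-W W—B at-B) (m≤n+m r (suc r))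
    where
    r+1<m : suc r < m
    r+1<m = ≤-<-trans (m≤m+n (suc r) r) 2r+1<m
    0<n : 0 < n
    0<n = ≤-<-trans z≤n r+1<n
    W B : Square m n
    W = square r+1<m r+1<n
    B = square 2r+1<m 0<n
    at-W : At W (suc r) (suc r)
    at-W = square-at r+1<m r+1<n
    at-B : At B (suc r + r) 0
    at-B = square-at 2r+1<m 0<n
    W—B : Consecutive W B
    W—B = right-edge-consecutive at-B m≤3r+1 (<-trans z<s 1<r)
            (adjacent-at at-B at-W (inj₁ (∣m+n-m∣≡n (suc r) r , refl)))

  no-circuit-for-3r+1<m≤4r : ∀ {f} → suc f < r → m ≡ suc f + r + suc r + r → suc r < n → ⊥
  no-circuit-for-3r+1<m≤4r {f} f+1<r m≡ r+1<n =
    <⇒≱ (apex-consecutive⇒col<r f+1<r r+1<n at-W W—B at-B)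
        (≤-trans (m≤n+m r (suc f)) (m≤m+n (suc f + r) (suc r)))
    where
    1<r : 1 < r
    1<r = ≤-<-trans (s≤s z≤n) f+1<r
    B<m : suc f + r + suc r < m
    B<m = subst (suc f + r + suc r <_) (sym m≡) (m<m+n (suc f + r + suc r) (<-trans z<s 1<r))
    W<m : suc f + r < m
    W<m = ≤-<-trans (m≤m+n (suc f + r) (suc r)) B<m
    1<n : 1 < n
    1<n = ≤-<-trans (s≤s z≤n) r+1<n
    W B : Square m n
    W = square W<m r+1<n
    B = square B<m 1<n
    at-W : At W (suc f + r) (suc r)
    at-W = square-at W<m r+1<n
    at-B : At B (suc f + r + suc r) 1
    at-B = square-at B<m 1<n
    W—B : Consecutive W B
    W—B = right-edge-consecutive at-B (≤-reflexive m≡) 1<r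
            (adjacent-at at-B at-W (inj₂ (∣m+n-m∣≡n (suc f + r) (suc r) , refl)))

  [3r,1]—[2r,r+2] : ∀ {t P W} → suc (suc t) ≡ r → m ≡ suc (suc t) + r + suc r + r → suc (suc r) < n →
                    At P (suc (suc t) + r + r) 1 → At W (suc (suc t) + r) (suc (suc r)) → Consecutive P W
  [3r,1]—[2r,r+2] {t} {P} 2+t≡r m≡ r+2<n at-P at-W =
    near-right-edge-consecutive at-P m≤P+1+r (≤-<-trans (s≤s z≤n) t+1<r) at-Q P≁Q at-W
    where
    a : ℕ
    a = suc t + r
    t+1<r : suc t < r
    t+1<r = subst (suc t <_) 2+t≡r (n<1+n (suc t))
    x+y+z≡x+z+y : ∀ x y z → x + y + z ≡ x + z + y
    x+y+z≡x+z+y = solve-∀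
    m≤P+1+r : m ≤ suc a + r + suc r
    m≤P+1+r = ≤-reflexive (trans m≡ (x+y+z≡x+z+y (suc a) (suc r) r))
    a<m : a < m
    a<m = <-trans (n<1+n a) (At⇒x<m at-W)
    r+1<n : suc r < n
    r+1<n = <-trans (n<1+n (suc r)) r+2<n
    Q : Square m n
    Q = square a<m r+1<n
    at-Q : At Q a (suc r)
    at-Q = square-at a<m r+1<n
    P≁Q : ¬ Consecutive P Q
    P≁Q P—Q = <⇒≱ (apex-consecutive⇒col<r t+1<r r+1<n at-Q (Consecutive-sym P—Q) at-P) (m≤n+m r (suc a))

  no-circuit-for-m≡4r+1 : ∀ {t} → 2 < r → suc (suc t) ≡ r → m ≡ suc (suc t) + r + suc r + r →
                          suc (suc r) < n → ⊥
  no-circuit-for-m≡4r+1 {t} 2<r 2+t≡r m≡ r+2<n =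
    no-three-neighbours W—A W—B (Consecutive-sym ([3r,1]—[2r,r+2] 2+t≡r m≡ r+2<n at-P at-W))
      (At-distinct-col at-A at-B (<⇒≢ A<B)) (At-distinct-row at-A at-P λ ()) (At-distinct-row at-B at-P λ ())
    where
    a : ℕ
    a = suc t + r
    t+1<r : suc t < r
    t+1<r = subst (suc t <_) 2+t≡r (n<1+n (suc t))
    B<m : suc a + suc r < m
    B<m = subst (suc a + suc r <_) (sym m≡) (m<m+n (suc a + suc r) (<-≤-trans z<s 2<r))
    P<m : suc a + r < m
    P<m = ≤-<-trans (+-monoʳ-≤ (suc a) (n≤1+n r)) B<m
    W<m : suc a < m
    W<m = ≤-<-trans (m≤m+n (suc a) r) P<m
    A<B : suc t < suc a + suc r
    A<B = <-≤-trans (s≤s (m≤m+n (suc t) r)) (m≤m+n (suc a) (suc r))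
    A<m : suc t < m
    A<m = <-trans A<B B<m
    2<n : 2 < n
    2<n = ≤-<-trans (s≤s (s≤s z≤n)) r+2<n
    1<n : 1 < n
    1<n = <-trans (n<1+n 1) 2<n
    W P B A : Square m n
    W = square W<m r+2<n
    P = square P<m 1<n
    B = square B<m 2<n
    A = square A<m 2<n
    at-W : At W (suc a) (suc (suc r))
    at-W = square-at W<m r+2<n
    at-P : At P (suc a + r) 1
    at-P = square-at P<m 1<n
    at-B : At B (suc a + suc r) 2
    at-B = square-at B<m 2<n
    at-A : At A (suc t) 2
    at-A = square-at A<m 2<n
    W—A : Consecutive W A
    W—A = corner-consecutive at-A t+1<r 2<r
            (adjacent-at at-A at-W (inj₂ (∣m-1+m+n∣≡1+n (suc t) r , refl)))
    W—B : Consecutive W B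
    W—B = right-edge-consecutive at-B (≤-reflexive m≡) 2<r
            (adjacent-at at-B at-W (inj₂ (∣m+n-m∣≡n (suc a) (suc r) , refl)))

width-cases : ∀ {r m} → 1 < r → m < 4 * r + 2 →
  m ≤ suc r + r + r
  ⊎ (∃ λ f → suc f < r × m ≡ suc f + r + suc r + r)
  ⊎ (∃ λ t → suc (suc t) ≡ r × m ≡ suc (suc t) + r + suc r + r)
width-cases {r} {m} 1<r m<4r+2 with m ≤? suc r + r + r
... | yes m≤3r+1 = inj₁ m≤3r+1
... | no m≰3r+1 with f , 3r+2+f≡m ← m≤n⇒∃[o]m+o≡n (≰⇒> m≰3r+1) = inj₂ (split f f<r m≡)
  where
  3r+2+f≡ : ∀ r f → suc (suc r + r + r) + f ≡ suc f + r + suc r + r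
  3r+2+f≡ = solve-∀
  4r+2≡ : ∀ r → 4 * r + 2 ≡ suc (suc r + r + r) + r
  4r+2≡ = solve-∀
  m≡ : m ≡ suc f + r + suc r + r
  m≡ = trans (sym 3r+2+f≡m) (3r+2+f≡ r f)
  f<r : f < r
  f<r = +-cancelˡ-< (suc (suc r + r + r)) f r (subst₂ _<_ (sym 3r+2+f≡m) (4r+2≡ r) m<4r+2)
  split : ∀ f → f < r → m ≡ suc f + r + suc r + r →
          (∃ λ f → suc f < r × m ≡ suc f + r + suc r + r)
          ⊎ (∃ λ t → suc (suc t) ≡ r × m ≡ suc (suc t) + r + suc r + r)
  split f f<r m≡ with m≤n⇒m<n∨m≡n f<r
  ... | inj₁ f+1<r = inj₁ (f , f+1<r , m≡)
  split zero    _ _  | inj₂ 1≡r   = ⊥-elim (<-irrefl 1≡r 1<r)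
  split (suc t) _ m≡ | inj₂ 2+t≡r = inj₂ (t , 2+t≡r , m≡)

no-circuit : ∀ {r m n} → 2 < r → suc (r + r) < m → m < 4 * r + 2 → m ≤ n →
             ¬ HamiltonianCircuit r (suc r) m n
no-circuit {r} {m} {n} 2<r 2r+1<m m<4r+2 m≤n (c , c-bijective , c-edges) =
  [ (λ m≤3r+1 → no-circuit-for-m≤3r+1 (<⇒≤ 2<r) 2r+1<m m≤3r+1 r+1<n)
  , [ (λ (f , f+1<r , m≡) → no-circuit-for-3r+1<m≤4r f+1<r m≡ r+1<n)
    , (λ (t , 2+t≡r , m≡) → no-circuit-for-m≡4r+1 2<r 2+t≡r m≡ r+2<n)
    ]
  ] (width-cases (<⇒≤ 2<r) m<4r+2)
  where
  3≤m : 3 ≤ m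
  3≤m = ≤-trans 2<r (≤-trans (m≤m+n r r) (≤-trans (n≤1+n (r + r)) (<⇒≤ 2r+1<m)))
  3≤mn : 3 ≤ m * n
  3≤mn = *-mono-≤ {3} {m} {1} {n} 3≤m (≤-trans (≤-trans (s≤s z≤n) 3≤m) m≤n)
  r+2<n : suc (suc r) < n
  r+2<n = <-≤-trans (≤-<-trans (s≤s (+-monoˡ-≤ r (≤-trans (s≤s z≤n) 2<r))) 2r+1<m) m≤n
  r+1<n : suc r < n
  r+1<n = <-trans (n<1+n (suc r)) r+2<n
  open LeaperCircuit 3≤mn c-bijective c-edges

theorem2 : (r m n : ℕ) → 2 < r → suc (2 * r) < m → m ≤ n →
    HamiltonianCircuit r (r + 1) m n → 4 * r + 2 ≤ m
theorem2 r m n 2<r 2r+1<m m≤n circuit with 4 * r + 2 ≤? m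
... | yes 4r+2≤m = 4r+2≤m
... | no 4r+2≰m =
  ⊥-elim (no-circuit 2<r (subst (λ k → suc (r + k) < m) (+-identityʳ r) 2r+1<m) (≰⇒> 4r+2≰m) m≤n
                     (subst (λ s → HamiltonianCircuit r s m n) (+-comm r 1) circuit))
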